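{- Let $G=(V,E)$ be a simple undirected graph on $n$ vertices and $m$ edges, and let $C>0$ be a parameter. Let $H:=\{x\in V:\deg(x)\geq C\sqrt{m}\}$. Suppose both of the following hold: - $D^{(2)}:=\sum_{x\in V}\deg^2(x)\geq (5C+2C^3)m^{3/2}$; - $|H|<C\sqrt{m}$. Then $$\sum_{v\in V}\frac{\deg(v,H)}{\deg(v)}>C\sqrt{m}.$$
   Context: For $v\in V$ and $S\subseteq V$, $\deg(v,S)$ denotes the number of neighbors of $v$ lying in $S$. The expression $\frac{\deg(v,H)}{\deg(v)}$ is understood for vertices with $\deg(v)\ge 1$; the graphs considered have no isolated vertices.
   Formalization: The parameter C ranges only over the positive rationals. -}

module Defs where

open import Data.Bool using (Bool; true; false; if_then_else_; _∧_)
open import Data.Nat as ℕ using (ℕ; zero; suc)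
open import Data.Fin using (Fin; zero; suc; toℕ)
open import Data.Integer using (+_)
open import Data.Rational using (ℚ; _/_; 0ℚ; _≤_; _<_)
import Data.Rational as Q
open import Data.Rational.Properties using (_≤?_)
open import Data.Product using (_×_)
open import Data.Sum using (_⊎_)
open import Relation.Binary.PropositionalEquality using (_≡_)
open import Relation.Nullary.Decidable using (⌊_⌋)

record SimpleGraph (n : ℕ) : Set where
  field
    adj    : Fin n → Fin n → Bool
    sym    : ∀ i j → adj i j ≡ adj j i
    irrefl : ∀ i → adj i i ≡ false
open SimpleGraph public

countF : ∀ {n} → (Fin n → Bool) → ℕ
countF {zero}  f = 0
countF {suc n} f = (if f zero then 1 else 0) ℕ.+ countF (λ i → f (suc i))

sumℕ : ∀ {n} → (Fin n → ℕ) → ℕ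
sumℕ {zero}  f = 0
sumℕ {suc n} f = f zero ℕ.+ sumℕ (λ i → f (suc i))

sumℚ : ∀ {n} → (Fin n → ℚ) → ℚ
sumℚ {zero}  f = 0ℚ
sumℚ {suc n} f = f zero Q.+ sumℚ (λ i → f (suc i))

ℕ→ℚ : ℕ → ℚ
ℕ→ℚ k = + k / 1

deg : ∀ {n} → SimpleGraph n → Fin n → ℕ
deg G v = countF (adj G v)

degIn : ∀ {n} → SimpleGraph n → (Fin n → Bool) → Fin n → ℕ
degIn G S v = countF (λ u → adj G v u ∧ S u)

edgeCount : ∀ {n} → SimpleGraph n → ℕ
edgeCount G = sumℕ (λ i → countF (λ j → adj G i j ∧ (toℕ i ℕ.<ᵇ toℕ j)))

D2 : ∀ {n} → SimpleGraph n → ℕ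
D2 G = sumℕ (λ x → deg G x ℕ.* deg G x)

-- Comparisons with c·√k for c ≥ 0 (c rational, k natural), phrased without
-- square roots (valid since c·√k ≥ 0):
--   c·√k ≤ q  iff  0 ≤ q and c²k ≤ q²
--   c·√k < q  iff  0 ≤ q and c²k < q²
--   q < c·√k  iff  q < 0 or q² < c²k
_·√_≤_ : ℚ → ℕ → ℚ → Set
c ·√ k ≤ q = (0ℚ ≤ q) × (c Q.* c Q.* ℕ→ℚ k ≤ q Q.* q)

_·√_<_ : ℚ → ℕ → ℚ → Set
c ·√ k < q = (0ℚ ≤ q) × (c Q.* c Q.* ℕ→ℚ k < q Q.* q)

_<_·√_ : ℚ → ℚ → ℕ → Set
q < c ·√ k = (q < 0ℚ) ⊎ (q Q.* q < c Q.* c Q.* ℕ→ℚ k)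

-- H = { x : deg(x) ≥ C √m }  (deg(x) ≥ 0, so only the squared test is needed)
H : ∀ {n} → SimpleGraph n → ℚ → Fin n → Bool
H G C x = ⌊ C Q.* C Q.* ℕ→ℚ (edgeCount G) ≤? ℕ→ℚ (deg G x) Q.* ℕ→ℚ (deg G x) ⌋

-- a / b as a rational (b = 0 gives 0; only used with b ≥ 1)
frac : ℕ → ℕ → ℚ
frac a zero    = 0ℚ
frac a (suc b) = + a / suc b

{-# OPTIONS --safe #-}
-- Write d for the degree, M = Σ d = 2m, P = Σ_{u ∈ H} d(u)² and T = Σ_v deg(v,H)/d(v).
-- AM-GM in the form 2 M d(v) d(u) ≤ M² + d(v)² d(u)², summed over the neighbours u ∈ H
-- of v, divided by d(v) and summed over v, gives 2MP ≤ M²T + MP, that is P ≤ MT.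
-- Vertices outside H have degree at most δ, where δ ≤ C√m, so D ≤ P + δM ≤ 2m(T + δ).
-- Since D ≥ (5C + 2C³) m^{3/2} > 4C m^{3/2} ≥ 4mδ, this leaves D < 4mT, hence T > C√m.
-- Every comparison with √m is made between squares. The bound on |H| is used only to
-- rule out m = 0.
module Submission where

open import Defs hiding (sym)
open import Data.Nat as ℕ using (ℕ; _≥_; _^_)
open import Data.Fin using (Fin)
import Data.Nat.Properties as ℕP
open import Algebra.Properties.Semiring.Sum ℕP.+-*-semiring
  using (sum; sum-cong-≗; ∑-distrib-+; ∑-comm; *-distribˡ-sum; *-distribʳ-sum)

module Counting where
  open import Data.Bool using (Bool; true; false; if_then_else_; _∧_)
  open import Data.Empty using (⊥-elim)
  open import Data.Fin using (zero; suc; toℕ)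
  open import Data.Fin.Properties using (toℕ-injective)
  open import Data.List using (_∷_; [])
  open import Data.Nat using (zero; suc; _+_; _*_; _≤_; _∸_; _<ᵇ_; z≤n)
  open import Data.Nat.Properties
  open import Data.Nat.Tactic.RingSolver using (solve-∀; solve)
  open import Data.Product using (∃-syntax; _×_; _,_)
  open import Data.Sum using (inj₁; inj₂)
  open import Function using (_∘_; case_of_)
  open import Relation.Binary.PropositionalEquality

  𝟙 : Bool → ℕ
  𝟙 b = if b then 1 else 0

  𝟙-∧ : ∀ a b → 𝟙 (a ∧ b) ≡ 𝟙 a * 𝟙 b
  𝟙-∧ false b = refl
  𝟙-∧ true  b = sym (*-identityˡ (𝟙 b))

  𝟙-∧-≤ʳ : ∀ a b → 𝟙 (a ∧ b) ≤ 𝟙 b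
  𝟙-∧-≤ʳ false b = z≤n
  𝟙-∧-≤ʳ true  b = ≤-refl

  sumℕ≡sum : ∀ {n} (f : Fin n → ℕ) → sumℕ f ≡ sum f
  sumℕ≡sum {zero}  f = refl
  sumℕ≡sum {suc n} f = cong (f zero +_) (sumℕ≡sum (f ∘ suc))

  countF≡sum : ∀ {n} (p : Fin n → Bool) → countF p ≡ sum (𝟙 ∘ p)
  countF≡sum {zero}  p = refl
  countF≡sum {suc n} p = cong (𝟙 (p zero) +_) (countF≡sum (p ∘ suc))

  sum-mono-≤ : ∀ {n} {f g : Fin n → ℕ} → (∀ i → f i ≤ g i) → sum f ≤ sum g
  sum-mono-≤ {zero}  f≤g = z≤n
  sum-mono-≤ {suc n} f≤g = +-mono-≤ (f≤g zero) (sum-mono-≤ (f≤g ∘ suc))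

  m^3≡m*m*m : ∀ m → m ^ 3 ≡ m * m * m
  m^3≡m*m*m m = trans (cong (λ x → m * (m * x)) (*-identityʳ m)) (sym (*-assoc m m m))

  2m[m+k]≤m²+[m+k]² : ∀ m k → 2 * m * (m + k) ≤ m * m + (m + k) * (m + k)
  2m[m+k]≤m²+[m+k]² m k = begin
    2 * m * (m + k)            ≤⟨ m≤m+n _ (k * k) ⟩
    2 * m * (m + k) + k * k    ≡⟨ solve (m ∷ k ∷ []) ⟩
    m * m + (m + k) * (m + k)  ∎
    where open ≤-Reasoning

  2mn≤m²+n²-ordered : ∀ {m n} → m ≤ n → 2 * m * n ≤ m * m + n * n
  2mn≤m²+n²-ordered {m} {n} m≤n =
    subst (λ x → 2 * m * x ≤ m * m + x * x) (m+[n∸m]≡n m≤n) (2m[m+k]≤m²+[m+k]² m (n ∸ m))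

  2mn≤m²+n² : ∀ m n → 2 * m * n ≤ m * m + n * n
  2mn≤m²+n² m n with ≤-total m n
  ... | inj₁ m≤n = 2mn≤m²+n²-ordered m≤n
  ... | inj₂ n≤m = subst₂ _≤_ (2ab≡2ba n m) (+-comm (n * n) (m * m)) (2mn≤m²+n²-ordered n≤m)
    where
    2ab≡2ba : ∀ a b → 2 * a * b ≡ 2 * b * a
    2ab≡2ba = solve-∀

  weighted-2mn≤m²+n² : ∀ {n} a c (w x : Fin n → ℕ) →
    c * (2 * a * sum (λ u → w u * x u)) ≤ sum w * (a * a) + c * (c * sum (λ u → w u * (x u * x u)))
  weighted-2mn≤m²+n² {n} a c w x = begin
    c * (2 * a * sum (λ u → w u * x u))
      ≡⟨ trans (sym (*-assoc c (2 * a) _)) (*-distribˡ-sum {n} (c * (2 * a)) _) ⟩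
    sum (λ u → c * (2 * a) * (w u * x u))
      ≡⟨ sum-cong-≗ (λ u → factor (w u) (x u)) ⟩
    sum (λ u → w u * (2 * a * (c * x u)))
      ≤⟨ sum-mono-≤ (λ u → *-monoʳ-≤ (w u) (2mn≤m²+n² a (c * x u))) ⟩
    sum (λ u → w u * (a * a + c * x u * (c * x u)))
      ≡⟨ sum-cong-≗ (λ u → expand (w u) (x u)) ⟩
    sum (λ u → w u * (a * a) + c * c * (w u * (x u * x u)))
      ≡⟨ ∑-distrib-+ {n} _ _ ⟩
    sum (λ u → w u * (a * a)) + sum (λ u → c * c * (w u * (x u * x u)))
      ≡⟨ cong₂ _+_ (sym (*-distribʳ-sum (a * a) w)) (sym (*-distribˡ-sum {n} (c * c) _)) ⟩
    sum w * (a * a) + c * c * sum (λ u → w u * (x u * x u))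
      ≡⟨ cong (sum w * (a * a) +_) (*-assoc c c _) ⟩
    sum w * (a * a) + c * (c * sum (λ u → w u * (x u * x u)))  ∎
    where
    open ≤-Reasoning
    factor : ∀ w x → c * (2 * a) * (w * x) ≡ w * (2 * a * (c * x))
    factor w x = solve (a ∷ c ∷ w ∷ x ∷ [])
    expand : ∀ w x → w * (a * a + c * x * (c * x)) ≡ w * (a * a) + c * c * (w * (x * x))
    expand w x = solve (a ∷ c ∷ w ∷ x ∷ [])

  <ᵇ-trichotomy : ∀ {a b} → a ≢ b → 𝟙 (a <ᵇ b) + 𝟙 (b <ᵇ a) ≡ 1
  <ᵇ-trichotomy {zero}  {zero}  a≢b = ⊥-elim (a≢b refl)
  <ᵇ-trichotomy {zero}  {suc b} _   = refl
  <ᵇ-trichotomy {suc a} {zero}  _   = refl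
  <ᵇ-trichotomy {suc a} {suc b} a≢b = <ᵇ-trichotomy (a≢b ∘ cong suc)

  upper-bound-satisfying : ∀ {n} (P : ℕ → Set) (f : Fin n → ℕ) → P 0 → (∀ i → P (f i)) →
                           ∃[ b ] P b × (∀ i → f i ≤ b)
  upper-bound-satisfying {zero}  P f P0 Pf = 0 , P0 , λ ()
  upper-bound-satisfying {suc n} P f P0 Pf with upper-bound-satisfying P (f ∘ suc) P0 (Pf ∘ suc)
  ... | b , Pb , f≤b with ≤-total (f zero) b
  ...   | inj₁ f₀≤b = b , Pb , λ { zero → f₀≤b ; (suc i) → f≤b i }
  ...   | inj₂ b≤f₀ = f zero , Pf zero , λ { zero → ≤-refl ; (suc i) → ≤-trans (f≤b i) b≤f₀ }

  module _ {n} (G : SimpleGraph n) where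

    adj⇒≢ : ∀ {i j} → adj G i j ≡ true → toℕ i ≢ toℕ j
    adj⇒≢ {i} ij i≡j with refl ← toℕ-injective i≡j = case trans (sym ij) (irrefl G i) of λ ()

    𝟙-adj-split : ∀ i j →
      𝟙 (adj G i j) ≡ 𝟙 (adj G i j ∧ (toℕ i <ᵇ toℕ j)) + 𝟙 (adj G j i ∧ (toℕ j <ᵇ toℕ i))
    𝟙-adj-split i j rewrite SimpleGraph.sym G j i with adj G i j in ij
    ... | false = refl
    ... | true  = sym (<ᵇ-trichotomy (adj⇒≢ ij))

    handshake : sum (deg G) ≡ 2 * edgeCount G
    handshake = begin
      sum (deg G)
        ≡⟨ sum-cong-≗ (λ i → countF≡sum (adj G i)) ⟩
      sum (λ i → sum (λ j → 𝟙 (adj G i j)))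
        ≡⟨ sum-cong-≗ (λ i → sum-cong-≗ (𝟙-adj-split i)) ⟩
      sum (λ i → sum (λ j → e i j + e j i))
        ≡⟨ sum-cong-≗ (λ i → ∑-distrib-+ (e i) (λ j → e j i)) ⟩
      sum (λ i → sum (e i) + sum (λ j → e j i))
        ≡⟨ ∑-distrib-+ (λ i → sum (e i)) (λ i → sum (λ j → e j i)) ⟩
      sum (λ i → sum (e i)) + sum (λ i → sum (λ j → e j i))
        ≡⟨ cong (sum (λ i → sum (e i)) +_) (∑-comm (λ i j → e j i)) ⟩
      sum (λ i → sum (e i)) + sum (λ i → sum (e i))
        ≡⟨ cong (λ x → x + x) (sym edgeCount≡) ⟩
      edgeCount G + edgeCount G
        ≡⟨ cong (edgeCount G +_) (sym (+-identityʳ (edgeCount G))) ⟩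
      2 * edgeCount G  ∎
      where
      open ≡-Reasoning
      lower : Fin n → Fin n → Bool
      lower i j = adj G i j ∧ (toℕ i <ᵇ toℕ j)
      e : Fin n → Fin n → ℕ
      e i j = 𝟙 (lower i j)
      edgeCount≡ : edgeCount G ≡ sum (λ i → sum (e i))
      edgeCount≡ = trans (sumℕ≡sum (λ i → countF (lower i))) (sum-cong-≗ (λ i → countF≡sum (lower i)))

    sumDeg²In : (Fin n → Bool) → ℕ
    sumDeg²In S = sum (λ u → 𝟙 (S u) * (deg G u * deg G u))

    sumDegNbrIn : (Fin n → Bool) → Fin n → ℕ
    sumDegNbrIn S v = sum (λ u → 𝟙 (adj G v u ∧ S u) * deg G u)

    D2≤sumDeg²In+δ*sumDeg : ∀ S δ → (∀ u → S u ≡ false → deg G u ≤ δ) →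
                            D2 G ≤ sumDeg²In S + δ * sum (deg G)
    D2≤sumDeg²In+δ*sumDeg S δ bound = begin
      D2 G
        ≡⟨ sumℕ≡sum (λ u → deg G u * deg G u) ⟩
      sum (λ u → deg G u * deg G u)
        ≤⟨ sum-mono-≤ split ⟩
      sum (λ u → 𝟙 (S u) * (deg G u * deg G u) + δ * deg G u)
        ≡⟨ ∑-distrib-+ (λ u → 𝟙 (S u) * (deg G u * deg G u)) (λ u → δ * deg G u) ⟩
      sumDeg²In S + sum (λ u → δ * deg G u)
        ≡⟨ cong (sumDeg²In S +_) (sym (*-distribˡ-sum δ (deg G))) ⟩
      sumDeg²In S + δ * sum (deg G)  ∎
      where
      open ≤-Reasoning
      split : ∀ u → deg G u * deg G u ≤ 𝟙 (S u) * (deg G u * deg G u) + δ * deg G u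
      split u with S u in Su
      ... | true  = ≤-trans (≤-reflexive (sym (*-identityˡ _))) (m≤m+n _ _)
      ... | false = *-monoˡ-≤ (deg G u) (bound u Su)

    sum-sumDegNbrIn : ∀ S → sum (sumDegNbrIn S) ≡ sumDeg²In S
    sum-sumDegNbrIn S = begin
      sum (λ v → sum (λ u → 𝟙 (adj G v u ∧ S u) * deg G u))
        ≡⟨ ∑-comm (λ v u → 𝟙 (adj G v u ∧ S u) * deg G u) ⟩
      sum (λ u → sum (λ v → 𝟙 (adj G v u ∧ S u) * deg G u))
        ≡⟨ sum-cong-≗ (λ u → sum-cong-≗ (λ v → pull-out u v)) ⟩
      sum (λ u → sum (λ v → 𝟙 (adj G u v) * (𝟙 (S u) * deg G u)))
        ≡⟨ sum-cong-≗ (λ u → sym (*-distribʳ-sum (𝟙 (S u) * deg G u) (𝟙 ∘ adj G u))) ⟩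
      sum (λ u → sum (𝟙 ∘ adj G u) * (𝟙 (S u) * deg G u))
        ≡⟨ sum-cong-≗ (λ u → cong (_* (𝟙 (S u) * deg G u)) (sym (countF≡sum (adj G u)))) ⟩
      sum (λ u → deg G u * (𝟙 (S u) * deg G u))
        ≡⟨ sum-cong-≗ (λ u → x*[y*x]≡y*[x*x] (deg G u) (𝟙 (S u))) ⟩
      sumDeg²In S  ∎
      where
      open ≡-Reasoning
      pull-out : ∀ u v → 𝟙 (adj G v u ∧ S u) * deg G u ≡ 𝟙 (adj G u v) * (𝟙 (S u) * deg G u)
      pull-out u v rewrite SimpleGraph.sym G v u | 𝟙-∧ (adj G u v) (S u) =
        *-assoc (𝟙 (adj G u v)) (𝟙 (S u)) (deg G u)
      x*[y*x]≡y*[x*x] : ∀ x y → x * (y * x) ≡ y * (x * x)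
      x*[y*x]≡y*[x*x] = solve-∀

    sum-2a*sumDegNbrIn : ∀ S a → sum (λ v → 2 * a * sumDegNbrIn S v) ≡ a * sumDeg²In S + a * sumDeg²In S
    sum-2a*sumDegNbrIn S a = begin
      sum (λ v → 2 * a * sumDegNbrIn S v)  ≡⟨ sym (*-distribˡ-sum (2 * a) (sumDegNbrIn S)) ⟩
      2 * a * sum (sumDegNbrIn S)          ≡⟨ cong (2 * a *_) (sum-sumDegNbrIn S) ⟩
      2 * a * sumDeg²In S                  ≡⟨ 2xy≡xy+xy a (sumDeg²In S) ⟩
      a * sumDeg²In S + a * sumDeg²In S    ∎
      where
      open ≡-Reasoning
      2xy≡xy+xy : ∀ x y → 2 * x * y ≡ x * y + x * y
      2xy≡xy+xy = solve-∀

    sumDegNbrIn-amgm : ∀ S a v →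
      deg G v * (2 * a * sumDegNbrIn S v) ≤ degIn G S v * (a * a) + deg G v * (deg G v * sumDeg²In S)
    sumDegNbrIn-amgm S a v = begin
      deg G v * (2 * a * sumDegNbrIn S v)
        ≤⟨ weighted-2mn≤m²+n² a (deg G v) w (deg G) ⟩
      sum w * (a * a) + deg G v * (deg G v * sum (λ u → w u * (deg G u * deg G u)))
        ≤⟨ +-mono-≤ (≤-reflexive (cong (_* (a * a)) (sym (countF≡sum nbrIn))))
                    (*-monoʳ-≤ (deg G v) (*-monoʳ-≤ (deg G v) (sum-mono-≤ w≤𝟙S))) ⟩
      degIn G S v * (a * a) + deg G v * (deg G v * sumDeg²In S)  ∎
      where
      open ≤-Reasoning
      nbrIn : Fin n → Bool
      nbrIn u = adj G v u ∧ S u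
      w : Fin n → ℕ
      w = 𝟙 ∘ nbrIn
      w≤𝟙S : ∀ u → w u * (deg G u * deg G u) ≤ 𝟙 (S u) * (deg G u * deg G u)
      w≤𝟙S u = *-monoˡ-≤ (deg G u * deg G u) (𝟙-∧-≤ʳ (adj G v u) (S u))

open Counting
open import Data.Bool using (Bool; true; false; if_then_else_)
open import Data.Empty using (⊥-elim)
open import Data.Fin using (zero; suc)
import Data.Integer as ℤ
import Data.Integer.Properties as ℤP
open import Data.Nat using (zero; suc; z≤n)
import Data.Nat.Coprimality as Coprimality
open import Data.Product using (∃-syntax; _×_; _,_)
open import Data.Rational using (ℚ; _+_; _*_; _<_; 0ℚ)
open import Data.Rational as ℚ using (mkℚ; _≤_; 1ℚ; toℚᵘ; positive; nonNegative)
import Data.Rational.Properties as ℚP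
import Data.Rational.Unnormalised as ℚᵘ
import Data.Rational.Unnormalised.Properties as ℚᵘP
open import Data.Sum using (inj₁; inj₂)
open import Function using (_∘_)
open import Level using (0ℓ)
open import Relation.Binary.PropositionalEquality
open import Relation.Nullary using (no)
open import Relation.Nullary.Decidable using (⌊_⌋; dec⇒maybe)
open import Tactic.RingSolver using (solve-∀)
open import Tactic.RingSolver.Core.AlmostCommutativeRing using (AlmostCommutativeRing; fromCommutativeRing)

ℚ-ring : AlmostCommutativeRing 0ℓ 0ℓ
ℚ-ring = fromCommutativeRing ℚP.+-*-commutativeRing (λ q → dec⇒maybe (0ℚ ℚP.≟ q))

ℕ→ℚ≡mkℚ : ∀ k → ℕ→ℚ k ≡ mkℚ (ℤ.+ k) 0 (Coprimality.sym (Coprimality.1-coprimeTo k))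
ℕ→ℚ≡mkℚ k = ℚP.normalize-coprime (Coprimality.sym (Coprimality.1-coprimeTo k))

ℕ→ℚ-+ : ∀ a b → ℕ→ℚ (a ℕ.+ b) ≡ ℕ→ℚ a + ℕ→ℚ b
ℕ→ℚ-+ a b rewrite ℕ→ℚ≡mkℚ a | ℕ→ℚ≡mkℚ b =
  cong (ℚ._/ 1) (sym (cong₂ ℤ._+_ (ℤP.*-identityʳ (ℤ.+ a)) (ℤP.*-identityʳ (ℤ.+ b))))

ℕ→ℚ-* : ∀ a b → ℕ→ℚ (a ℕ.* b) ≡ ℕ→ℚ a * ℕ→ℚ b
ℕ→ℚ-* a b rewrite ℕ→ℚ≡mkℚ a | ℕ→ℚ≡mkℚ b = cong (ℚ._/ 1) (ℤP.pos-* a b)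

ℕ→ℚ-mono-≤ : ∀ {a b} → a ℕ.≤ b → ℕ→ℚ a ≤ ℕ→ℚ b
ℕ→ℚ-mono-≤ {a} {b} a≤b rewrite ℕ→ℚ≡mkℚ a | ℕ→ℚ≡mkℚ b =
  ℚ.*≤* (ℤP.*-monoʳ-≤-nonNeg (ℤ.+ 1) (ℤ.+≤+ a≤b))

0≤ℕ→ℚ : ∀ k → 0ℚ ≤ ℕ→ℚ k
0≤ℕ→ℚ k = ℕ→ℚ-mono-≤ {0} {k} z≤n

0<ℕ→ℚ : ∀ {k} → 1 ℕ.≤ k → 0ℚ < ℕ→ℚ k
0<ℕ→ℚ 1≤k = ℚP.<-≤-trans (ℚP.positive⁻¹ 1ℚ) (ℕ→ℚ-mono-≤ 1≤k)

ℕ→ℚ-^3 : ∀ k → ℕ→ℚ (k ^ 3) ≡ ℕ→ℚ k * ℕ→ℚ k * ℕ→ℚ k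
ℕ→ℚ-^3 k = begin
  ℕ→ℚ (k ^ 3)            ≡⟨ cong ℕ→ℚ (m^3≡m*m*m k) ⟩
  ℕ→ℚ (k ℕ.* k ℕ.* k)    ≡⟨ ℕ→ℚ-* (k ℕ.* k) k ⟩
  ℕ→ℚ (k ℕ.* k) * ℕ→ℚ k  ≡⟨ cong (_* ℕ→ℚ k) (ℕ→ℚ-* k k) ⟩
  ℕ→ℚ k * ℕ→ℚ k * ℕ→ℚ k  ∎
  where open ≡-Reasoning

ℕ→ℚ-*-frac : ∀ k d → ℕ→ℚ (suc d) * frac k (suc d) ≡ ℕ→ℚ k
ℕ→ℚ-*-frac k d = ℚP.toℚᵘ-injective (begin
  toℚᵘ (ℕ→ℚ (suc d) * frac k (suc d))
    ≈⟨ ℚP.toℚᵘ-homo-* (ℕ→ℚ (suc d)) (frac k (suc d)) ⟩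
  toℚᵘ (ℕ→ℚ (suc d)) ℚᵘ.* toℚᵘ (frac k (suc d))
    ≈⟨ ℚᵘP.*-cong (ℚP.toℚᵘ-fromℚᵘ (ℚᵘ.mkℚᵘ (ℤ.+ suc d) 0)) (ℚP.toℚᵘ-fromℚᵘ (ℚᵘ.mkℚᵘ (ℤ.+ k) d)) ⟩
  ℚᵘ.mkℚᵘ (ℤ.+ suc d) 0 ℚᵘ.* ℚᵘ.mkℚᵘ (ℤ.+ k) d
    ≈⟨ ℚᵘ.*≡* cross ⟩
  ℚᵘ.mkℚᵘ (ℤ.+ k) 0
    ≈⟨ ℚᵘP.≃-sym (ℚP.toℚᵘ-fromℚᵘ (ℚᵘ.mkℚᵘ (ℤ.+ k) 0)) ⟩
  toℚᵘ (ℕ→ℚ k)  ∎)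
  where
  open ℚᵘP.≃-Reasoning
  cross : (ℤ.+ suc d ℤ.* ℤ.+ k) ℤ.* ℤ.+ 1 ≡ ℤ.+ k ℤ.* ℤ.+ suc (d ℕ.+ 0)
  cross = trans (ℤP.*-identityʳ (ℤ.+ suc d ℤ.* ℤ.+ k))
                (trans (ℤP.*-comm (ℤ.+ suc d) (ℤ.+ k)) (cong (λ x → ℤ.+ k ℤ.* ℤ.+ suc x) (sym (ℕP.+-identityʳ d))))

frac-nonNeg : ∀ k d → 0ℚ ≤ frac k d
frac-nonNeg k zero    = ℚP.≤-refl
frac-nonNeg k (suc d) = ℚP.nonNegative⁻¹ _ {{ℚP.normalize-nonNeg k (suc d)}}

d*x≤k*y+d*z⇒x≤[k/d]*y+z : ∀ {x y z k d} → 1 ℕ.≤ d → d ℕ.* x ℕ.≤ k ℕ.* y ℕ.+ d ℕ.* z →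
                          ℕ→ℚ x ≤ frac k d * ℕ→ℚ y + ℕ→ℚ z
d*x≤k*y+d*z⇒x≤[k/d]*y+z {x} {y} {z} {k} {suc d} 1≤d dx≤ky+dz =
  ℚP.*-cancelˡ-≤-pos d̂ {{positive (0<ℕ→ℚ 1≤d)}} (begin
    d̂ * ℕ→ℚ x                                  ≡⟨ sym (ℕ→ℚ-* (suc d) x) ⟩
    ℕ→ℚ (suc d ℕ.* x)                          ≤⟨ ℕ→ℚ-mono-≤ dx≤ky+dz ⟩
    ℕ→ℚ (k ℕ.* y ℕ.+ suc d ℕ.* z)              ≡⟨ ℕ→ℚ-+ (k ℕ.* y) (suc d ℕ.* z) ⟩
    ℕ→ℚ (k ℕ.* y) + ℕ→ℚ (suc d ℕ.* z)          ≡⟨ cong₂ _+_ (ℕ→ℚ-* k y) (ℕ→ℚ-* (suc d) z) ⟩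
    ℕ→ℚ k * ℕ→ℚ y + d̂ * ℕ→ℚ z                  ≡⟨ cong (λ q → q * ℕ→ℚ y + d̂ * ℕ→ℚ z) (sym (ℕ→ℚ-*-frac k d)) ⟩
    d̂ * frac k (suc d) * ℕ→ℚ y + d̂ * ℕ→ℚ z     ≡⟨ factor d̂ (frac k (suc d)) (ℕ→ℚ y) (ℕ→ℚ z) ⟩
    d̂ * (frac k (suc d) * ℕ→ℚ y + ℕ→ℚ z)       ∎)
  where
  open ℚP.≤-Reasoning
  d̂ = ℕ→ℚ (suc d)
  factor : ∀ a b c e → a * b * c + a * e ≡ a * (b * c + e)
  factor = solve-∀ ℚ-ring

sum-ℕ→ℚ-≤ : ∀ {n} (f : Fin n → ℕ) (t : Fin n → ℚ) c (g : Fin n → ℕ) →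
            (∀ i → ℕ→ℚ (f i) ≤ t i * c + ℕ→ℚ (g i)) → ℕ→ℚ (sum f) ≤ sumℚ t * c + ℕ→ℚ (sum g)
sum-ℕ→ℚ-≤ {zero}  f t c g _     = ℚP.≤-reflexive (sym (trans (ℚP.+-identityʳ (0ℚ * c)) (ℚP.*-zeroˡ c)))
sum-ℕ→ℚ-≤ {suc n} f t c g bound = begin
  ℕ→ℚ (f zero ℕ.+ sum (f ∘ suc))
    ≡⟨ ℕ→ℚ-+ (f zero) (sum (f ∘ suc)) ⟩
  ℕ→ℚ (f zero) + ℕ→ℚ (sum (f ∘ suc))
    ≤⟨ ℚP.+-mono-≤ (bound zero) (sum-ℕ→ℚ-≤ (f ∘ suc) (t ∘ suc) c (g ∘ suc) (bound ∘ suc)) ⟩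
  (t zero * c + ℕ→ℚ (g zero)) + (sumℚ (t ∘ suc) * c + ℕ→ℚ (sum (g ∘ suc)))
    ≡⟨ regroup (t zero) (sumℚ (t ∘ suc)) c (ℕ→ℚ (g zero)) (ℕ→ℚ (sum (g ∘ suc))) ⟩
  (t zero + sumℚ (t ∘ suc)) * c + (ℕ→ℚ (g zero) + ℕ→ℚ (sum (g ∘ suc)))
    ≡⟨ cong ((t zero + sumℚ (t ∘ suc)) * c +_) (sym (ℕ→ℚ-+ (g zero) (sum (g ∘ suc)))) ⟩
  (t zero + sumℚ (t ∘ suc)) * c + ℕ→ℚ (g zero ℕ.+ sum (g ∘ suc))  ∎
  where
  open ℚP.≤-Reasoning
  regroup : ∀ a b c x y → (a * c + x) + (b * c + y) ≡ (a + b) * c + (x + y)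
  regroup = solve-∀ ℚ-ring

sumℚ-nonNeg : ∀ {n} {t : Fin n → ℚ} → (∀ i → 0ℚ ≤ t i) → 0ℚ ≤ sumℚ t
sumℚ-nonNeg {zero}  _   = ℚP.≤-refl
sumℚ-nonNeg {suc n} 0≤t = ℚP.+-mono-≤ (0≤t zero) (sumℚ-nonNeg (0≤t ∘ suc))

+-cancelʳ-≤ : ∀ {p q r} → p + r ≤ q + r → p ≤ q
+-cancelʳ-≤ {r = r} p+r≤q+r = ℚP.≮⇒≥ (λ q<p → ℚP.<-irrefl refl (ℚP.≤-<-trans p+r≤q+r (ℚP.+-monoˡ-< r q<p)))

square-mono-≤ : ∀ {p q} → 0ℚ ≤ p → p ≤ q → p * p ≤ q * q
square-mono-≤ {p} {q} 0≤p p≤q = ℚP.≤-trans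
  (ℚP.*-monoˡ-≤-nonNeg p {{nonNegative 0≤p}} p≤q)
  (ℚP.*-monoʳ-≤-nonNeg q {{nonNegative (ℚP.≤-trans 0≤p p≤q)}} p≤q)

square-mono-< : ∀ {p q} → 0ℚ ≤ p → p < q → p * p < q * q
square-mono-< {p} {q} 0≤p p<q = ℚP.≤-<-trans
  (ℚP.*-monoʳ-≤-nonNeg p {{nonNegative 0≤p}} (ℚP.<⇒≤ p<q))
  (ℚP.*-monoʳ-<-pos q {{positive (ℚP.≤-<-trans 0≤p p<q)}} p<q)

square-cancel-< : ∀ {p q} → 0ℚ ≤ q → p * p < q * q → p < q
square-cancel-< 0≤q p²<q² = ℚP.≰⇒> (λ q≤p → ℚP.<-irrefl refl (ℚP.<-≤-trans p²<q² (square-mono-≤ 0≤q q≤p)))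

⌊≤?⌋≡false⇒> : ∀ {p q} → ⌊ p ℚP.≤? q ⌋ ≡ false → q < p
⌊≤?⌋≡false⇒> {p} {q} _ with p ℚP.≤? q
... | no p≰q = ℚP.≰⇒> p≰q

0<c*c*x⇒0<x : ∀ {c x} → 0ℚ < c → 0ℚ < c * c * x → 0ℚ < x
0<c*c*x⇒0<x {c} {x} 0<c 0<c²x =
  ℚP.*-cancelˡ-<-nonNeg (c * c) {{ℚP.pos⇒nonNeg (c * c) {{ℚP.pos*pos⇒pos c {{c-pos}} c {{c-pos}}}}}}
    (subst (_< c * c * x) (sym (ℚP.*-zeroʳ (c * c))) 0<c²x)
  where c-pos = positive 0<c

<c·√k⇒0<c²k : ∀ {q c k} → 0ℚ ≤ q → q < c ·√ k → 0ℚ < c * c * ℕ→ℚ k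
<c·√k⇒0<c²k 0≤q (inj₁ q<0)    = ⊥-elim (ℚP.<-irrefl refl (ℚP.≤-<-trans 0≤q q<0))
<c·√k⇒0<c²k 0≤q (inj₂ q²<c²k) = ℚP.≤-<-trans (square-mono-≤ ℚP.≤-refl 0≤q) q²<c²k

degInRatioSum : ∀ {n} → SimpleGraph n → (Fin n → Bool) → ℚ
degInRatioSum G S = sumℚ (λ v → frac (degIn G S v) (deg G v))

sumDeg²In≤sumDeg*degInRatioSum : ∀ {n} (G : SimpleGraph n) S → (∀ v → deg G v ≥ 1) →
  ℕ→ℚ (sumDeg²In G S) ≤ ℕ→ℚ (sum (deg G)) * degInRatioSum G S
sumDeg²In≤sumDeg*degInRatioSum {zero}  G S _           = ℚP.≤-refl
sumDeg²In≤sumDeg*degInRatioSum {suc n} G S no-isolated =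
  ℚP.*-cancelˡ-≤-pos M̂ {{positive (0<ℕ→ℚ (ℕP.≤-trans (no-isolated zero) (ℕP.m≤m+n _ _)))}}
    (+-cancelʳ-≤ (begin
      M̂ * P̂ + M̂ * P̂
        ≡⟨ sym (trans (ℕ→ℚ-+ (M ℕ.* P) (M ℕ.* P)) (cong₂ _+_ (ℕ→ℚ-* M P) (ℕ→ℚ-* M P))) ⟩
      ℕ→ℚ (M ℕ.* P ℕ.+ M ℕ.* P)
        ≡⟨ cong ℕ→ℚ (sym (sum-2a*sumDegNbrIn G S M)) ⟩
      ℕ→ℚ (sum (λ v → 2 ℕ.* M ℕ.* sumDegNbrIn G S v))
        ≤⟨ sum-ℕ→ℚ-≤ (λ v → 2 ℕ.* M ℕ.* sumDegNbrIn G S v) (λ v → frac (degIn G S v) (deg G v))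
                     (ℕ→ℚ (M ℕ.* M)) (λ v → deg G v ℕ.* P) per-vertex ⟩
      T * ℕ→ℚ (M ℕ.* M) + ℕ→ℚ (sum (λ v → deg G v ℕ.* P))
        ≡⟨ cong₂ (λ x y → T * x + ℕ→ℚ y) (ℕ→ℚ-* M M) (sym (*-distribʳ-sum P (deg G))) ⟩
      T * (M̂ * M̂) + ℕ→ℚ (M ℕ.* P)
        ≡⟨ cong₂ _+_ (regroup T M̂) (ℕ→ℚ-* M P) ⟩
      M̂ * (M̂ * T) + M̂ * P̂  ∎))
  where
  open ℚP.≤-Reasoning
  M = sum (deg G)
  P = sumDeg²In G S
  M̂ = ℕ→ℚ M
  P̂ = ℕ→ℚ P
  T = degInRatioSum G S
  per-vertex : ∀ v → ℕ→ℚ (2 ℕ.* M ℕ.* sumDegNbrIn G S v) ≤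
                     frac (degIn G S v) (deg G v) * ℕ→ℚ (M ℕ.* M) + ℕ→ℚ (deg G v ℕ.* P)
  per-vertex v = d*x≤k*y+d*z⇒x≤[k/d]*y+z (no-isolated v) (sumDegNbrIn-amgm G S M v)
  regroup : ∀ a b → a * (b * b) ≡ b * (b * a)
  regroup = solve-∀ ℚ-ring

D2≤2m[degInRatioSum+δ] : ∀ {n} (G : SimpleGraph n) S δ → (∀ v → deg G v ≥ 1) →
  (∀ u → S u ≡ false → deg G u ℕ.≤ δ) →
  ℕ→ℚ (D2 G) ≤ ℕ→ℚ 2 * ℕ→ℚ (edgeCount G) * (degInRatioSum G S + ℕ→ℚ δ)
D2≤2m[degInRatioSum+δ] G S δ no-isolated bound = begin
  ℕ→ℚ (D2 G)          ≤⟨ ℕ→ℚ-mono-≤ (D2≤sumDeg²In+δ*sumDeg G S δ bound) ⟩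
  ℕ→ℚ (P ℕ.+ δ ℕ.* M) ≡⟨ trans (ℕ→ℚ-+ P (δ ℕ.* M)) (cong (ℕ→ℚ P +_) (ℕ→ℚ-* δ M)) ⟩
  ℕ→ℚ P + δ̂ * M̂       ≤⟨ ℚP.+-monoˡ-≤ (δ̂ * M̂) (sumDeg²In≤sumDeg*degInRatioSum G S no-isolated) ⟩
  M̂ * T + δ̂ * M̂       ≡⟨ factor M̂ T δ̂ ⟩
  M̂ * (T + δ̂)         ≡⟨ cong (_* (T + δ̂)) (trans (cong ℕ→ℚ (handshake G)) (ℕ→ℚ-* 2 (edgeCount G))) ⟩
  ℕ→ℚ 2 * ℕ→ℚ (edgeCount G) * (T + δ̂)  ∎
  where
  open ℚP.≤-Reasoning
  M = sum (deg G)
  P = sumDeg²In G S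
  M̂ = ℕ→ℚ M
  δ̂ = ℕ→ℚ δ
  T = degInRatioSum G S
  factor : ∀ a b c → a * b + c * a ≡ a * (b + c)
  factor = solve-∀ ℚ-ring

degree-bound-outside-H : ∀ {n} (G : SimpleGraph n) C → 0ℚ ≤ C * C * ℕ→ℚ (edgeCount G) →
  ∃[ δ ] ℕ→ℚ δ * ℕ→ℚ δ ≤ C * C * ℕ→ℚ (edgeCount G) × (∀ u → H G C u ≡ false → deg G u ℕ.≤ δ)
degree-bound-outside-H {n} G C 0≤C²m =
  let δ , δ²≤C²m , f≤δ = upper-bound-satisfying small f 0≤C²m f-small
  in  δ , δ²≤C²m , λ u Hu≡false → subst (λ b → (if b then 0 else deg G u) ℕ.≤ δ) Hu≡false (f≤δ u)
  where
  small : ℕ → Set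
  small b = ℕ→ℚ b * ℕ→ℚ b ≤ C * C * ℕ→ℚ (edgeCount G)
  f : Fin n → ℕ
  f u = if H G C u then 0 else deg G u
  f-small : ∀ u → small (f u)
  f-small u = by-cases (H G C u) refl
    where
    -- not a `with`: abstracting H G C u makes Agda evaluate the rational arithmetic in the goal
    by-cases : ∀ b → H G C u ≡ b → small (if b then 0 else deg G u)
    by-cases true  _  = 0≤C²m
    by-cases false Hu = ℚP.<⇒≤ (⌊≤?⌋≡false⇒> Hu)

D≤b[T+δ]⇒s²<T² : ∀ {b s² T δ D} → 0ℚ < b → 0ℚ ≤ D → δ * δ ≤ s² → (b + b) * (b + b) * s² < D * D →
                  D ≤ b * (T + δ) → s² < T * T
D≤b[T+δ]⇒s²<T² {b} {s²} {T} {δ} {D} 0<b 0≤D δ²≤s² a²s²<D² D≤b[T+δ] =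
  ℚP.*-cancelˡ-<-nonNeg (a * a) {{nonNegative (ℚP.<⇒≤ 0<a²)}} (begin-strict
    a * a * s²         <⟨ a²s²<D² ⟩
    D * D              ≤⟨ square-mono-≤ 0≤D (ℚP.<⇒≤ D<aT) ⟩
    (a * T) * (a * T)  ≡⟨ swap a T ⟩
    a * a * (T * T)    ∎)
  where
  open ℚP.≤-Reasoning
  a = b + b
  0<a² : 0ℚ < a * a
  0<a² = ℚP.positive⁻¹ _ {{ℚP.pos*pos⇒pos a {{a-pos}} a {{a-pos}}}}
    where a-pos = ℚP.pos+pos⇒pos b {{positive 0<b}} b {{positive 0<b}}
  swap : ∀ x y → (x * y) * (x * y) ≡ x * x * (y * y)
  swap = solve-∀ ℚ-ring
  aδ<D : a * δ < D
  aδ<D = square-cancel-< 0≤D (begin-strict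
    (a * δ) * (a * δ)  ≡⟨ swap a δ ⟩
    a * a * (δ * δ)    ≤⟨ ℚP.*-monoˡ-≤-nonNeg (a * a) {{nonNegative (ℚP.<⇒≤ 0<a²)}} δ²≤s² ⟩
    a * a * s²         <⟨ a²s²<D² ⟩
    D * D              ∎)
  D+D≤aT+aδ : D + D ≤ a * T + a * δ
  D+D≤aT+aδ = begin
    D + D                      ≤⟨ ℚP.+-mono-≤ D≤b[T+δ] D≤b[T+δ] ⟩
    b * (T + δ) + b * (T + δ)  ≡⟨ expand b T δ ⟩
    a * T + a * δ              ∎
    where
    expand : ∀ x y z → x * (y + z) + x * (y + z) ≡ (x + x) * y + (x + x) * z
    expand = solve-∀ ℚ-ring
  D<aT : D < a * T
  D<aT = ℚP.≰⇒> (λ aT≤D → ℚP.<-irrefl refl (ℚP.≤-<-trans D+D≤aT+aδ (ℚP.+-mono-≤-< aT≤D aδ<D)))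

4C<5C+2C³ : ∀ {C} → 0ℚ < C → ℕ→ℚ 4 * C < ℕ→ℚ 5 * C + ℕ→ℚ 2 * (C * C * C)
4C<5C+2C³ {C} 0<C = begin-strict
  ℕ→ℚ 4 * C                               ≡⟨ sym (ℚP.+-identityʳ (ℕ→ℚ 4 * C)) ⟩
  ℕ→ℚ 4 * C + 0ℚ                          <⟨ ℚP.+-monoʳ-< (ℕ→ℚ 4 * C) (ℚP.positive⁻¹ _ {{C+2C³-pos}}) ⟩
  ℕ→ℚ 4 * C + (C + ℕ→ℚ 2 * (C * C * C))  ≡⟨ regroup C ⟩
  ℕ→ℚ 5 * C + ℕ→ℚ 2 * (C * C * C)        ∎
  where
  open ℚP.≤-Reasoning
  instance
    C-pos : ℚ.Positive C
    C-pos = positive 0<C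
  C+2C³-pos : ℚ.Positive (C + ℕ→ℚ 2 * (C * C * C))
  C+2C³-pos = ℚP.pos+pos⇒pos C (ℕ→ℚ 2 * (C * C * C))
    {{ℚP.pos*pos⇒pos (ℕ→ℚ 2) (C * C * C) {{ℚP.pos*pos⇒pos (C * C) {{ℚP.pos*pos⇒pos C C}} C}}}}
  regroup : ∀ c → ℕ→ℚ 4 * c + (c + ℕ→ℚ 2 * (c * c * c)) ≡ ℕ→ℚ 5 * c + ℕ→ℚ 2 * (c * c * c)
  regroup = solve-∀ ℚ-ring

K²x³≤D²⇒[4x]²C²x<D² : ∀ {C x D} → 0ℚ < C → 0ℚ < x →
  (ℕ→ℚ 5 * C + ℕ→ℚ 2 * (C * C * C)) * (ℕ→ℚ 5 * C + ℕ→ℚ 2 * (C * C * C)) * (x * x * x) ≤ D * D →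
  (ℕ→ℚ 2 * x + ℕ→ℚ 2 * x) * (ℕ→ℚ 2 * x + ℕ→ℚ 2 * x) * (C * C * x) < D * D
K²x³≤D²⇒[4x]²C²x<D² {C} {x} {D} 0<C 0<x K²x³≤D² = begin-strict
  (ℕ→ℚ 2 * x + ℕ→ℚ 2 * x) * (ℕ→ℚ 2 * x + ℕ→ℚ 2 * x) * (C * C * x)
    ≡⟨ regroup C x ⟩
  (ℕ→ℚ 4 * C) * (ℕ→ℚ 4 * C) * (x * x * x)
    <⟨ ℚP.*-monoˡ-<-pos (x * x * x) {{x³-pos}} (square-mono-< 0≤4C (4C<5C+2C³ 0<C)) ⟩
  K * K * (x * x * x)
    ≤⟨ K²x³≤D² ⟩
  D * D  ∎
  where
  open ℚP.≤-Reasoning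
  K = ℕ→ℚ 5 * C + ℕ→ℚ 2 * (C * C * C)
  instance
    C-pos : ℚ.Positive C
    C-pos = positive 0<C
    x-pos : ℚ.Positive x
    x-pos = positive 0<x
  x³-pos : ℚ.Positive (x * x * x)
  x³-pos = ℚP.pos*pos⇒pos (x * x) {{ℚP.pos*pos⇒pos x x}} x
  0≤4C : 0ℚ ≤ ℕ→ℚ 4 * C
  0≤4C = ℚP.<⇒≤ (ℚP.positive⁻¹ (ℕ→ℚ 4 * C) {{ℚP.pos*pos⇒pos (ℕ→ℚ 4) C}})
  regroup : ∀ c y → (ℕ→ℚ 2 * y + ℕ→ℚ 2 * y) * (ℕ→ℚ 2 * y + ℕ→ℚ 2 * y) * (c * c * y)
                    ≡ (ℕ→ℚ 4 * c) * (ℕ→ℚ 4 * c) * (y * y * y)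
  regroup = solve-∀ ℚ-ring

lemma4p10 : (n : ℕ) (G : SimpleGraph n) (C : ℚ) → 0ℚ < C
    → (∀ v → deg G v ≥ 1)
    → ((ℕ→ℚ 5 * C + ℕ→ℚ 2 * (C * C * C)) ·√ (edgeCount G ^ 3) ≤ ℕ→ℚ (D2 G))
    → (ℕ→ℚ (countF (H G C)) < C ·√ edgeCount G)
    → C ·√ edgeCount G < sumℚ (λ v → frac (degIn G (H G C) v) (deg G v))
lemma4p10 n G C 0<C no-isolated (0≤D , K²m³≤D²) |H|<C√m =
  let δ , δ²≤C²m , outside-H-deg≤δ = degree-bound-outside-H G C (ℚP.<⇒≤ 0<C²m)
  in  sumℚ-nonNeg (λ v → frac-nonNeg (degIn G (H G C) v) (deg G v)) ,
      D≤b[T+δ]⇒s²<T² {T = degInRatioSum G (H G C)} {δ = ℕ→ℚ δ} 0<2m 0≤D δ²≤C²m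
        (K²x³≤D²⇒[4x]²C²x<D² {D = D} 0<C 0<m (subst (λ x → K * K * x ≤ D * D) (ℕ→ℚ-^3 (edgeCount G)) K²m³≤D²))
        (D2≤2m[degInRatioSum+δ] G (H G C) δ no-isolated outside-H-deg≤δ)
  where
  K = ℕ→ℚ 5 * C + ℕ→ℚ 2 * (C * C * C)
  D = ℕ→ℚ (D2 G)
  0<C²m : 0ℚ < C * C * ℕ→ℚ (edgeCount G)
  0<C²m = <c·√k⇒0<c²k {c = C} {k = edgeCount G} (0≤ℕ→ℚ (countF (H G C))) |H|<C√m
  0<m : 0ℚ < ℕ→ℚ (edgeCount G)
  0<m = 0<c*c*x⇒0<x 0<C 0<C²m
  0<2m : 0ℚ < ℕ→ℚ 2 * ℕ→ℚ (edgeCount G)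
  0<2m = ℚP.positive⁻¹ (ℕ→ℚ 2 * ℕ→ℚ (edgeCount G))
           {{ℚP.pos*pos⇒pos (ℕ→ℚ 2) (ℕ→ℚ (edgeCount G)) {{positive 0<m}}}}
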